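{- Let $k\ge2$, let $G=(V,E)$ be a graph, and let $L$ be a sequence of moves that is valid from an initial configuration $\tau_0\in[k]^V$. If $v\in V\setminus S(L)$, then $P_{L,\tau_0}[\{a,v\},C]=0$ for every cycle $C\in\Gamma(L)$ and every edge $\{a,v\}\in E$.
   Context: A configuration is $\tau\in[k]^V$ (part of each vertex). A move is a triple $(v,p,q)$ with $v\in V$, $p,q\in[k]$, $p\ne q$; it is valid for $\tau$ if $\tau(v)=p$. A sequence of moves $L$ has moves $L(t)=(v_t,p_t,q_t)$, $t\in[\ell(L)]$; $S(L)$ is the set of vertices $v_t$. $L$ is valid from $\tau_0$ if each $L(t)$ is valid for $\tau_{t-1}$, where $\tau_t$ is obtained from $\tau_{t-1}$ by setting $\tau_t(v_t):=q_t$. $M_{L,\tau_0}\in\{0,\pm1\}^{E\times[\ell(L)]}$ has $M_{L,\tau_0}[\{a,b\},t]=+1$ if ($a=v_t$ and $q_t=\tau_t(b)$) or ($b=v_t$ and $q_t=\tau_t(a)$); $-1$ if ($a=v_t$ and $p_t=\tau_t(b)$) or ($b=v_t$ and $p_t=\tau_t(a)$); $0$ otherwise. A $w$-circuit over $v$ is a set of time steps $t_1<\dots<t_w$ with $v_{t_i}=v$ for all $i$, $q_{t_i}=p_{t_{i+1}}$ for $i\in[w-1]$, and $q_{t_w}=p_{t_1}$; a cycle is an inclusion-wise minimal circuit; $T(C)$ denotes its set of time steps and $\Gamma(L)$ the set of all cycles of $L$. $P_{L,\tau_0}\in\mathbb{Z}^{E\times\Gamma(L)}$ has $P_{L,\tau_0}[\{a,b\},C]:=\sum_{t\in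 T(C)}M_{L,\tau_0}[\{a,b\},t]$. -}

module Defs where

open import Data.Nat using (ℕ; zero; suc)
open import Data.Fin using (Fin; toℕ; _<_; _≟_)
open import Data.Integer using (ℤ; +_; -_; _+_)
open import Data.List using (List; []; _∷_; length; lookup; take; map; foldr)
open import Data.List.Relation.Unary.All using (All)
open import Data.List.Relation.Unary.Linked using (Linked)
open import Data.List.Relation.Binary.Subset.Propositional using (_⊆_)
open import Data.Product using (Σ; _×_; ∃)
open import Data.Sum using (_⊎_)
open import Data.Unit using (⊤)
open import Data.Empty using (⊥)
open import Relation.Nullary using (¬_; Dec; yes; no)
open import Relation.Nullary.Decidable using (_×-dec_; _⊎-dec_)
open import Relation.Binary.PropositionalEquality using (_≡_; _≢_)

-- A (finite, simple, undirected) graph on vertex set Fin n.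
-- An edge {a,b} ∈ E is represented by Adj a b (symmetric, irreflexive).
record Graph (n : ℕ) : Set₁ where
  field
    Adj    : Fin n → Fin n → Set
    sym    : ∀ {a b} → Adj a b → Adj b a
    irrefl : ∀ {a} → ¬ Adj a a

-- Configurations τ ∈ [k]^V (parts/colours are Fin k).
Config : ℕ → ℕ → Set
Config n k = Fin n → Fin k

record Move (n k : ℕ) : Set where
  constructor move
  field
    v   : Fin n
    p   : Fin k
    q   : Fin k
    p≢q : p ≢ q
open Move public

apply : ∀ {n k} → Config n k → Move n k → Config n k
apply τ m x with x ≟ v m
... | yes _ = q m
... | no  _ = τ x

run : ∀ {n k} → Config n k → List (Move n k) → Config n k
run τ []      = τ
run τ (m ∷ L) = run (apply τ m) L

Valid : ∀ {n k} → Config n k → List (Move n k) → Set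
Valid τ []      = ⊤
Valid τ (m ∷ L) = (τ (v m) ≡ p m) × Valid (apply τ m) L

InS : ∀ {n k} → List (Move n k) → Fin n → Set
InS L x = Data.List.Relation.Unary.Any.Any (λ m → v m ≡ x) L
  where import Data.List.Relation.Unary.Any

-- Time steps of L are Fin (length L); index i corresponds to t = i+1.
Time : ∀ {n k} → List (Move n k) → Set
Time L = Fin (length L)

τAt : ∀ {n k} → Config n k → (L : List (Move n k)) → Time L → Config n k
τAt τ0 L i = run τ0 (take (suc (toℕ i)) L)

M : ∀ {n k} → Config n k → (L : List (Move n k)) → Fin n → Fin n → Time L → ℤ
M τ0 L a b t with
    ((a ≟ v m) ×-dec (q m ≟ τ b)) ⊎-dec ((b ≟ v m) ×-dec (q m ≟ τ a))
  | ((a ≟ v m) ×-dec (p m ≟ τ b)) ⊎-dec ((b ≟ v m) ×-dec (p m ≟ τ a))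
  where
    m = lookup L t
    τ = τAt τ0 L t
... | yes _ | _     = + 1
... | no _  | yes _ = - (+ 1)
... | no _  | no _  = + 0

lastOf : ∀ {A : Set} → A → List A → A
lastOf t []       = t
lastOf t (u ∷ us) = lastOf u us

IsCircuit : ∀ {n k} → (L : List (Move n k)) → List (Time L) → Set
IsCircuit L []       = ⊥
IsCircuit {n} L (t ∷ ts) =
    Linked _<_ (t ∷ ts)
  × (Σ (Fin n) λ x → All (λ s → v (lookup L s) ≡ x) (t ∷ ts))
  × Linked (λ s s' → q (lookup L s) ≡ p (lookup L s')) (t ∷ ts)
  × (q (lookup L (lastOf t ts)) ≡ p (lookup L t))

-- A cycle: an inclusion-wise minimal circuit (identified with its set T(C)
-- of time steps, listed increasingly).
IsCycle : ∀ {n k} → (L : List (Move n k)) → List (Time L) → Set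
IsCycle L C = IsCircuit L C × (∀ C' → IsCircuit L C' → C' ⊆ C → C ⊆ C')

P : ∀ {n k} → Config n k → (L : List (Move n k)) → Fin n → Fin n → List (Time L) → ℤ
P τ0 L a b C = foldr _+_ (+ 0) (map (M τ0 L a b) C)

module Submission where

-- Let x be a vertex that no move of L touches, and let
-- c = τ0(x).  Then τ_t(x) = c for every time step t (x is "frozen").  Fix a
-- cycle C over some vertex y and an edge {a,x}; since x ≠ y, the entry
-- M[{a,x},t] for t ∈ T(C) is governed by whether a is the moving vertex y:
--   * if a ≠ y, no endpoint of {a,x} moves at time t, so the entry is 0;
--   * if a = y, the entry is  [q_t = c] − [p_t = c], the change the move
--     makes in whether a has the colour c of its neighbour x.
-- In the second case the consecutive moves of a circuit chain (q_{t_i} =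
-- p_{t_{i+1}}) and close up (q_{t_w} = p_{t_1}), so the sum over T(C)
-- telescopes to [p_{t_1} = c] − [p_{t_1} = c] = 0.

open import Defs
open import Data.Nat using (ℕ; _≤_; suc)
open import Data.Fin using (Fin; toℕ; _≟_)
open import Data.List using (List; []; _∷_; take; lookup; map; foldr)
open import Data.List.Membership.Propositional using (lose)
open import Data.List.Membership.Propositional.Properties using (∈-lookup)
open import Data.List.Properties using (map-cong-local)
open import Data.List.Relation.Unary.All as All using (All; []; _∷_)
open import Data.List.Relation.Unary.All.Properties using (¬Any⇒All¬; take⁺)
open import Data.List.Relation.Unary.Linked using (Linked; _∷_)
open import Data.Integer using (ℤ; +_; _+_; _-_)
open import Data.Integer.Properties using (+-comm; +-identityʳ; +-minus-telescope; i≡j⇒i-j≡0)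
open import Data.Product using (_,_)
open import Data.Empty using (⊥-elim)
open import Relation.Nullary using (¬_; yes; no)
open import Relation.Binary.PropositionalEquality
  using (_≡_; _≢_; refl; sym; trans; cong; cong₂; module ≡-Reasoning)

sumℤ : List ℤ → ℤ
sumℤ = foldr _+_ (+ 0)

telescope : ∀ {A B : Set} (φ : B → ℤ) (inn out : A → B) (s : A) (ss : List A)
  → Linked (λ s s' → out s ≡ inn s') (s ∷ ss)
  → sumℤ (map (λ r → φ (out r) - φ (inn r)) (s ∷ ss)) ≡ φ (out (lastOf s ss)) - φ (inn s)
telescope φ inn out s [] _ = +-identityʳ _
telescope φ inn out s (s' ∷ ss) (chain ∷ chains) = begin
  (φ (out s) - φ (inn s)) + sumℤ (map (λ r → φ (out r) - φ (inn r)) (s' ∷ ss))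
    ≡⟨ cong (λ rest → (φ (out s) - φ (inn s)) + rest) (telescope φ inn out s' ss chains) ⟩
  (φ (out s) - φ (inn s)) + (φ (out (lastOf s' ss)) - φ (inn s'))
    ≡⟨ cong (λ b → (φ (out s) - φ (inn s)) + (φ (out (lastOf s' ss)) - φ b)) (sym chain) ⟩
  (φ (out s) - φ (inn s)) + (φ (out (lastOf s' ss)) - φ (out s))
    ≡⟨ +-minus-telescope-rev (φ (out s)) (φ (inn s)) (φ (out (lastOf s' ss))) ⟩
  φ (out (lastOf s' ss)) - φ (inn s) ∎
  where
    open ≡-Reasoning
    +-minus-telescope-rev : ∀ i j l → (i - j) + (l - i) ≡ l - j
    +-minus-telescope-rev i j l =
      trans (+-comm (i - j) (l - i)) (+-minus-telescope l i j)

sumℤ-zeros : ∀ {A : Set} (f : A → ℤ) (xs : List A) → All (λ s → f s ≡ + 0) xs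
  → sumℤ (map f xs) ≡ + 0
sumℤ-zeros f [] [] = refl
sumℤ-zeros f (s ∷ xs) (fs≡0 ∷ rest) = cong₂ _+_ fs≡0 (sumℤ-zeros f xs rest)

indicator : ∀ {k} → Fin k → Fin k → ℤ
indicator c y with y ≟ c
... | yes _ = + 1
... | no  _ = + 0

module _ {n k : ℕ} where

  apply-elsewhere : (τ : Config n k) (m : Move n k) (x : Fin n)
    → x ≢ v m → apply τ m x ≡ τ x
  apply-elsewhere τ m x x≢m with x ≟ v m
  ... | yes x≡m = ⊥-elim (x≢m x≡m)
  ... | no  _   = refl

  run-untouched : (x : Fin n) (τ : Config n k) (L : List (Move n k))
    → All (λ m → ¬ v m ≡ x) L → run τ L x ≡ τ x
  run-untouched x τ [] [] = refl
  run-untouched x τ (m ∷ L) (m≢x ∷ rest) =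
    trans (run-untouched x (apply τ m) L rest) (apply-elsewhere τ m x (λ x≡m → m≢x (sym x≡m)))

  colour-frozen : (τ0 : Config n k) (L : List (Move n k)) (x : Fin n)
    → ¬ InS L x → (t : Time L) → τAt τ0 L t x ≡ τ0 x
  colour-frozen τ0 L x x∉S t =
    run-untouched x τ0 (take (suc (toℕ t)) L) (take⁺ (suc (toℕ t)) (¬Any⇒All¬ L x∉S))

  not-mover : (L : List (Move n k)) (x : Fin n) → ¬ InS L x
    → (t : Time L) → x ≢ v (lookup L t)
  not-mover L x x∉S t x≡mover = x∉S (lose (∈-lookup t) (sym x≡mover))

  change : Fin k → Move n k → ℤ
  change c m = indicator c (q m) - indicator c (p m)

  M-at-mover : (τ0 : Config n k) (L : List (Move n k)) (a x : Fin n) (t : Time L)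
    → a ≡ v (lookup L t) → x ≢ v (lookup L t)
    → M τ0 L a x t ≡ change (τAt τ0 L t x) (lookup L t)
  M-at-mover τ0 L a x t a-moves x-stays
    with a ≟ v (lookup L t) | x ≟ v (lookup L t)
       | q (lookup L t) ≟ τAt τ0 L t x | p (lookup L t) ≟ τAt τ0 L t x
  ... | no a-stays | _           | _       | _       = ⊥-elim (a-stays a-moves)
  ... | yes _      | yes x-moves | _       | _       = ⊥-elim (x-stays x-moves)
  ... | yes _      | no _        | yes q≡c | yes p≡c = ⊥-elim (p≢q (lookup L t) (trans p≡c (sym q≡c)))
  ... | yes _      | no _        | yes _   | no _    = refl
  ... | yes _      | no _        | no _    | yes _   = refl
  ... | yes _      | no _        | no _    | no _    = refl

  M-away : (τ0 : Config n k) (L : List (Move n k)) (a x : Fin n) (t : Time L)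
    → a ≢ v (lookup L t) → x ≢ v (lookup L t) → M τ0 L a x t ≡ + 0
  M-away τ0 L a x t a-stays x-stays with a ≟ v (lookup L t) | x ≟ v (lookup L t)
  ... | yes a-moves | _           = ⊥-elim (a-stays a-moves)
  ... | no _        | yes x-moves = ⊥-elim (x-stays x-moves)
  ... | no _        | no _        = refl

proposition4p9 : ∀ {n k : ℕ} → 2 ≤ k → (G : Graph n) → (τ0 : Config n k)
    → (L : List (Move n k)) → Valid τ0 L
    → (x : Fin n) → ¬ InS L x
    → (C : List (Time L)) → IsCycle L C
    → (a : Fin n) → Graph.Adj G a x
    → P τ0 L a x C ≡ + 0
proposition4p9 _ _ τ0 L _ x x∉S [] (() , _) a _
proposition4p9 _ _ τ0 L _ x x∉S (t ∷ ts) ((_ , (y , over-y) , chained , closed) , _) a _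
  with a ≟ y
... | no a≢y = sumℤ-zeros (M τ0 L a x) (t ∷ ts)
      (All.map (λ {s} s-over-y → M-away τ0 L a x s (λ a≡ → a≢y (trans a≡ s-over-y)) (not-mover L x x∉S s)) over-y)
... | yes a≡y = begin
  sumℤ (map (M τ0 L a x) (t ∷ ts))
    ≡⟨ cong sumℤ (map-cong-local (All.map entry over-y)) ⟩
  sumℤ (map (λ s → change (τ0 x) (lookup L s)) (t ∷ ts))
    ≡⟨ telescope (indicator (τ0 x)) (λ s → p (lookup L s)) (λ s → q (lookup L s)) t ts chained ⟩
  indicator (τ0 x) (q (lookup L (lastOf t ts))) - indicator (τ0 x) (p (lookup L t))
    ≡⟨ i≡j⇒i-j≡0 (cong (indicator (τ0 x)) closed) ⟩
  + 0 ∎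
  where
    open ≡-Reasoning
    -- On the cycle a is the mover, so each entry is the change in colour τ0(x).
    entry : ∀ {s} → v (lookup L s) ≡ y → M τ0 L a x s ≡ change (τ0 x) (lookup L s)
    entry {s} s-over-y =
      trans (M-at-mover τ0 L a x s (trans a≡y (sym s-over-y)) (not-mover L x x∉S s))
            (cong (λ c → change c (lookup L s)) (colour-frozen τ0 L x x∉S s))
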